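{- Let $D=\{T_1,\ldots,T_t\}$ be a collection of documents over an alphabet $\Sigma$, each document terminated by a symbol $\$\notin\Sigma$ lexicographically smaller than every symbol of $\Sigma$, and let $\mathcal{D}[1..n]=T_1T_2\cdots T_t$ be their concatenation, with suffix array $\mathsf{SA}$, document array $\mathsf{DA}$ and double run-length encoded interleaved LCP array $\mathsf{ILCP}^\bigstar$ (all defined in the context). Let $P[1..m]$ be a pattern over $\Sigma$ that occurs in $\mathcal{D}$, and let $\mathsf{SA}[s_p..e_p]$ be the interval of the suffix array containing exactly the suffixes of $\mathcal{D}$ that have $P$ as a prefix. Then the positions of the leftmost occurrences of the distinct document identifiers in $\mathsf{DA}[s_p..e_p]$ are exactly the positions of the values strictly less than $m$ in $\mathsf{ILCP}^\bigstar[s_p..e_p]$, where, if there are several positions with value smaller than $m$ for the same document, only the leftmost one is considered. Formally: the set $\{\min\{q\in[s_p,e_p]:\mathsf{DA}[q]=d\} : d\in\mathsf{DA}[s_p..e_p]\}$ equals the set of positions $q\in[s_p,e_p]$ such that $\mathsf{ILCP}^\bigstar[q]<m$ and there is no $q'\in[s_p,q)$ with $\mathsf{DA}[q']=\mathsf{DA}[q]$ and $\mathsf{ILCP}^\bigstar[q']<m$.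
   Context: The suffix array $\mathsf{SA}[1..n]$ of $\mathcal{D}$ lists the starting positions of the suffixes of $\mathcal{D}$ in lexicographic order. The document array $\mathsf{DA}[1..n]$ stores in position $i$ the index $k$ of the document $T_k$ that contains position $\mathsf{SA}[i]$ of $\mathcal{D}$. For a text $T$, its LCP array $\mathsf{LCP}_T$ stores in position $j\ge 2$ the length of the longest common prefix of the $(j-1)$-th and $j$-th lexicographically smallest suffixes of $T$, and $\mathsf{LCP}_T[1]=0$. The interleaved LCP array $\mathsf{ILCP}[1..n]$ is defined by $\mathsf{ILCP}[i]=\mathsf{LCP}_{T_k}[j]$ whenever $\mathsf{SA}[i]$ is the starting position in $\mathcal{D}$ of the $j$-th lexicographically smallest suffix of document $T_k$. Partition $[1..n]$ into the maximal runs of consecutive positions on which $\mathsf{ILCP}$ is constant (the run-length encoding of $\mathsf{ILCP}$). The array $\mathsf{ILCP}^\bigstar[1..n]$ is obtained by scanning these runs left to right and merging every maximal block of consecutive runs all of whose positions carry the same document identifier in $\mathsf{DA}$ into a single run; every position of a merged run receives as value the minimum of the $\mathsf{ILCP}$ values of the runs that were merged, while runs not merged with any other (in particular runs containing positions of more than one document) keep their $\mathsf{ILCP}$ value. -}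

module Defs where

open import Data.Nat using (ℕ; zero; suc; _<_; _≟_; _⊓_; _∸_)
open import Data.Nat.Base using (_<ᵇ_)
open import Data.Bool using (Bool; false; if_then_else_)
open import Data.Fin using (Fin; toℕ; zero; suc; inject₁)
open import Data.List using (List; []; _∷_; _++_; map; length; lookup; drop; replicate; concatMap; foldr; tabulate; [_])
open import Data.Maybe using (Maybe; just; nothing)
open import Data.Product using (_×_; _,_; proj₁; proj₂; ∃)
open import Relation.Nullary using (yes; no; does)
open import Relation.Binary.PropositionalEquality using (_≡_)
open import Data.List.Relation.Binary.Lex.Strict using (Lex-<)

-- Symbols of Σ are natural numbers; in texts a symbol a ∈ Σ is encoded as
-- (suc a), and the terminator $ is encoded as 0, so $ is strictly smaller
-- than every symbol of Σ.

_<lex_ : List ℕ → List ℕ → Set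
_<lex_ = Lex-< _≡_ _<_

enc : List ℕ → List ℕ
enc = map suc

term : List ℕ → List ℕ
term B = enc B ++ [ 0 ]

concatDocs : List (List ℕ) → List ℕ
concatDocs = concatMap term

suf : List ℕ → ℕ → List ℕ
suf T p = drop p T

lcp : List ℕ → List ℕ → ℕ
lcp (x ∷ xs) (y ∷ ys) with x ≟ y
... | yes _ = suc (lcp xs ys)
... | no _  = 0
lcp _ _ = 0

IsSuffixArray : (T : List ℕ) → (Fin (length T) → Fin (length T)) → Set
IsSuffixArray T SA =
  (∀ i j → toℕ i < toℕ j → suf T (toℕ (SA i)) <lex suf T (toℕ (SA j)))
  × (∀ p → ∃ λ i → SA i ≡ p)

LCPgen : (T : List ℕ) → ∀ {n} → (Fin n → ℕ) → Fin n → ℕ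
LCPgen T pos zero    = 0
LCPgen T pos (suc j) = lcp (suf T (pos (inject₁ j))) (suf T (pos (suc j)))

LCPArr : (T : List ℕ) → (Fin (length T) → Fin (length T)) → Fin (length T) → ℕ
LCPArr T SA = LCPgen T (λ i → toℕ (SA i))

-- Collections of documents, given by their bodies over Σ.

doc : (docs : List (List ℕ)) → Fin (length docs) → List ℕ
doc docs k = term (lookup docs k)

-- locate docs p = (k , o): position p of 𝒟 is offset o inside document k
-- (document identifiers are 0-based).
locate : List (List ℕ) → ℕ → ℕ × ℕ
locate [] p = (0 , p)
locate (B ∷ Bs) p =
  if p <ᵇ length (term B) then (0 , p)
  else (suc (proj₁ (locate Bs (p ∸ length (term B))))
       , proj₂ (locate Bs (p ∸ length (term B))))

len : List (List ℕ) → ℕ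
len docs = length (concatDocs docs)

DA : (docs : List (List ℕ)) → (Fin (len docs) → Fin (len docs)) → Fin (len docs) → ℕ
DA docs SA i = proj₁ (locate docs (toℕ (SA i)))

IsILCP : (docs : List (List ℕ)) → (SA : Fin (len docs) → Fin (len docs))
       → (SAs : (k : Fin (length docs)) → Fin (length (doc docs k)) → Fin (length (doc docs k)))
       → (Fin (len docs) → ℕ) → Set
IsILCP docs SA SAs ILCP =
  ∀ i (k : Fin (length docs)) (j : Fin (length (doc docs k)))
  → toℕ k ≡ proj₁ (locate docs (toℕ (SA i)))
  → toℕ (SAs k j) ≡ proj₂ (locate docs (toℕ (SA i)))
  → ILCP i ≡ LCPArr (doc docs k) (SAs k) j

-- A run of ILCP: its (constant) ILCP value and the list of DA values of
-- its positions, left to right.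
Run : Set
Run = ℕ × List ℕ

addPos : ℕ × ℕ → List Run → List Run
addPos (v , d) [] = (v , d ∷ []) ∷ []
addPos (v , d) ((w , ds) ∷ rs) with v ≟ w
... | yes _ = (w , d ∷ ds) ∷ rs
... | no _  = (v , d ∷ []) ∷ (w , ds) ∷ rs

runs : List (ℕ × ℕ) → List Run
runs = foldr addPos []

allEq : ℕ → List ℕ → Maybe ℕ
allEq d [] = just d
allEq d (e ∷ es) with d ≟ e
... | yes _ = allEq d es
... | no _  = nothing

uniformDoc : Run → Maybe ℕ
uniformDoc (v , [])     = nothing
uniformDoc (v , d ∷ ds) = allEq d ds

sameDoc : Run → Run → Bool
sameDoc r r' with uniformDoc r | uniformDoc r'
... | just d | just d' = does (d ≟ d')
... | _      | _       = false

addRun : Run → List (List Run) → List (List Run)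
addRun r [] = (r ∷ []) ∷ []
addRun r ([] ∷ bs) = (r ∷ []) ∷ [] ∷ bs
addRun r ((r' ∷ b) ∷ bs) =
  if sameDoc r r' then (r ∷ r' ∷ b) ∷ bs else (r ∷ []) ∷ (r' ∷ b) ∷ bs

blocks : List Run → List (List Run)
blocks = foldr addRun []

blockMin : List Run → ℕ
blockMin []            = 0
blockMin (r ∷ [])      = proj₁ r
blockMin (r ∷ r' ∷ rs) = proj₁ r ⊓ blockMin (r' ∷ rs)

expand : List Run → List ℕ
expand b = concatMap (λ r → replicate (length (proj₂ r)) (blockMin b)) b

ILCPstarList : List (ℕ × ℕ) → List ℕ
ILCPstarList xs = concatMap expand (blocks (runs xs))

lookupD : List ℕ → ℕ → ℕ
lookupD []       _       = 0
lookupD (x ∷ xs) zero    = x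
lookupD (x ∷ xs) (suc i) = lookupD xs i

ILCPstar : ∀ {n} → (Fin n → ℕ) → (Fin n → ℕ) → Fin n → ℕ
ILCPstar {n} ILCP DA' q = lookupD (ILCPstarList (tabulate (λ i → ILCP i , DA' i))) (toℕ q)

-- ILCP★ only lowers ILCP (each position of a merged block receives the block minimum), so a
-- leftmost occurrence q of a document T_k in SA[sp..ep] has ILCP★[q] < m as soon as ILCP[q] < m.
-- Were ILCP[q] ≥ m, the suffix of T_k just before SA[q] in the suffix array of T_k would share at
-- least m symbols with it and hence also start with P. Since every document ends with the unique
-- smallest symbol $, suffixes of T_k compare as their extensions in 𝒟 do, so that suffix occurs in
-- SA[sp..ep] strictly before q, contradicting leftmostness. Conversely, if q is not the leftmost
-- position of its document, the leftmost one is an earlier position with ILCP★ < m.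
module Submission where

open import Defs
open import Data.Bool using (true; false)
open import Data.Fin using (Fin; toℕ; zero; suc; fromℕ<; inject₁)
open import Data.Fin.Properties using (toℕ<n; toℕ-fromℕ<; toℕ-injective; toℕ-inject₁)
open import Data.List using (List; []; _∷_; _++_; length; map; concat; concatMap; replicate; drop; lookup; tabulate)
open import Data.List.Properties using (length-++; length-++-≤ˡ; length-map; map-tabulate; concatMap-++)
open import Data.List.Relation.Unary.All as All using (All; []; _∷_)
open import Data.List.Relation.Binary.Pointwise using (Pointwise; []; _∷_; ++⁺; replicate⁺)
import Data.List.Relation.Binary.Pointwise as Pointwise
open import Data.List.Relation.Binary.Prefix.Heterogeneous using (Prefix; []; _∷_; _++ᵖ_)
open import Data.List.Relation.Binary.Lex.Strict using (this; next; <-irreflexive; <-asymmetric)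
open import Data.Nat using (ℕ; zero; suc; _+_; _∸_; _<_; _≤_; _<ᵇ_; _≟_; _<?_; z≤n; s≤s; s≤s⁻¹)
open import Data.Nat.Induction using (<-wellFounded)
open import Data.Nat.Properties
open import Data.Sum using (_⊎_; inj₁; inj₂)
open import Data.Product using (Σ; _×_; ∃; _,_; proj₁; proj₂)
open import Function.Bundles using (_⇔_; mk⇔; Equivalence)
open import Induction.WellFounded using (Acc; acc)
open import Relation.Binary using (tri<; tri≈; tri>)
open import Relation.Binary.PropositionalEquality using (_≡_; refl; sym; trans; cong; subst; subst₂; resp₂; module ≡-Reasoning)
open import Relation.Nullary using (¬_; yes; no; contradiction)
open import Relation.Nullary.Reflects using (ofʸ; ofⁿ)

runValues : List Run → List ℕ
runValues = concatMap (λ r → replicate (length (proj₂ r)) (proj₁ r))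

runValues-++ : ∀ rs rs′ → runValues (rs ++ rs′) ≡ runValues rs ++ runValues rs′
runValues-++ = concatMap-++ _

runValues-addPos : ∀ x rs → runValues (addPos x rs) ≡ proj₁ x ∷ runValues rs
runValues-addPos (v , d) [] = refl
runValues-addPos (v , d) ((w , ds) ∷ rs) with v ≟ w
... | yes refl = refl
... | no _     = refl

runValues-runs : ∀ xs → runValues (runs xs) ≡ map proj₁ xs
runValues-runs []       = refl
runValues-runs (x ∷ xs) = trans (runValues-addPos x (runs xs)) (cong (proj₁ x ∷_) (runValues-runs xs))

concat-addRun : ∀ r bs → concat (addRun r bs) ≡ r ∷ concat bs
concat-addRun r []              = refl
concat-addRun r ([] ∷ bs)       = refl
concat-addRun r ((r′ ∷ b) ∷ bs) with sameDoc r r′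
... | true  = refl
... | false = refl

concat-blocks : ∀ rs → concat (blocks rs) ≡ rs
concat-blocks []       = refl
concat-blocks (r ∷ rs) = trans (concat-addRun r (blocks rs)) (cong (r ∷_) (concat-blocks rs))

blockMin-≤ : ∀ b → All (λ r → blockMin b ≤ proj₁ r) b
blockMin-≤ []            = []
blockMin-≤ (r ∷ [])      = ≤-refl ∷ []
blockMin-≤ (r ∷ r′ ∷ rs) =
  m⊓n≤m _ _ ∷ All.map (≤-trans (m⊓n≤n (proj₁ r) _)) (blockMin-≤ (r′ ∷ rs))

expand-≤-runValues : ∀ b → Pointwise _≤_ (expand b) (runValues b)
expand-≤-runValues b = lowered (blockMin-≤ b)
  where
  lowered : ∀ {b′} → All (λ r → blockMin b ≤ proj₁ r) b′
          → Pointwise _≤_ (concatMap (λ r → replicate (length (proj₂ r)) (blockMin b)) b′) (runValues b′)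
  lowered               []           = []
  lowered {b′ = r ∷ _} (min≤ ∷ mins≤) = ++⁺ (replicate⁺ min≤ (length (proj₂ r))) (lowered mins≤)

concatMap-expand-≤ : ∀ bs → Pointwise _≤_ (concatMap expand bs) (runValues (concat bs))
concatMap-expand-≤ []       = []
concatMap-expand-≤ (b ∷ bs) =
  subst (Pointwise _≤_ (concatMap expand (b ∷ bs))) (sym (runValues-++ b (concat bs)))
  (++⁺ (expand-≤-runValues b) (concatMap-expand-≤ bs))

ILCPstarList-≤ : ∀ xs → Pointwise _≤_ (ILCPstarList xs) (map proj₁ xs)
ILCPstarList-≤ xs = subst (Pointwise _≤_ (ILCPstarList xs))
  (trans (cong runValues (concat-blocks (runs xs))) (runValues-runs xs))
  (concatMap-expand-≤ (blocks (runs xs)))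

lookupD-mono : ∀ {xs ys} → Pointwise _≤_ xs ys → ∀ i → lookupD xs i ≤ lookupD ys i
lookupD-mono []         i       = ≤-refl
lookupD-mono (x≤y ∷ _)  zero    = x≤y
lookupD-mono (_ ∷ xs≤ys) (suc i) = lookupD-mono xs≤ys i

lookupD-tabulate : ∀ {n} (f : Fin n → ℕ) q → lookupD (tabulate f) (toℕ q) ≡ f q
lookupD-tabulate f zero    = refl
lookupD-tabulate f (suc q) = lookupD-tabulate (λ i → f (suc i)) q

ILCPstar≤ILCP : ∀ {n} (I D′ : Fin n → ℕ) q → ILCPstar I D′ q ≤ I q
ILCPstar≤ILCP I D′ q = subst (ILCPstar I D′ q ≤_) (lookupD-tabulate I q)
  (subst (λ xs → ILCPstar I D′ q ≤ lookupD xs (toℕ q)) (map-tabulate (λ i → I i , D′ i) proj₁)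
    (lookupD-mono (ILCPstarList-≤ (tabulate (λ i → I i , D′ i))) (toℕ q)))

<lex-irrefl : ∀ xs → ¬ xs <lex xs
<lex-irrefl xs = <-irreflexive <-irrefl (Pointwise.refl refl)

<lex-asym : ∀ {xs ys} → xs <lex ys → ¬ ys <lex xs
<lex-asym = <-asymmetric sym (resp₂ _<_) <-asym

SA-reflects-<lex : ∀ {T SA} → IsSuffixArray T SA → ∀ i j
                 → suf T (toℕ (SA i)) <lex suf T (toℕ (SA j)) → toℕ i < toℕ j
SA-reflects-<lex {T} {SA} (sorted , _) i j lt with <-cmp (toℕ i) (toℕ j)
... | tri< i<j _ _ = i<j
... | tri≈ _ i≡j _ = contradiction
  (subst (λ k → suf T (toℕ (SA k)) <lex suf T (toℕ (SA j))) (toℕ-injective i≡j) lt) (<lex-irrefl _)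
... | tri> _ _ j<i = contradiction (sorted j i j<i) (<lex-asym lt)

suf-term : ∀ B o → o < length (term B) → suf (term B) o ≡ term (drop o B)
suf-term B       zero    _       = refl
suf-term []      (suc o) (s≤s ())
suf-term (b ∷ B) (suc o) (s≤s o<) = suf-term B o o<

Prefix-enc-term-++⁻ : ∀ Z Y R → Prefix _≡_ (enc Z) (term Y ++ R) → Prefix _≡_ (enc Z) (term Y)
Prefix-enc-term-++⁻ []      Y       R _            = []
Prefix-enc-term-++⁻ (z ∷ Z) []      R (() ∷ _)
Prefix-enc-term-++⁻ (z ∷ Z) (y ∷ Y) R (eq ∷ pre) = eq ∷ Prefix-enc-term-++⁻ Z Y R pre

-- $ (encoded as 0) ends every document and is smaller than every other symbol,
-- so two terminated strings are already told apart before either one ends.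
term-<lex-++ : ∀ Y₁ Y₂ R₁ R₂ → term Y₁ <lex term Y₂ → (term Y₁ ++ R₁) <lex (term Y₂ ++ R₂)
term-<lex-++ []       []       R₁ R₂ lt          = contradiction lt (<lex-irrefl _)
term-<lex-++ []       (y ∷ Y₂) R₁ R₂ (this lt)   = this lt
term-<lex-++ (y ∷ Y₁) []       R₁ R₂ (this ())
term-<lex-++ (y ∷ Y₁) (_ ∷ Y₂) R₁ R₂ (this lt)   = this lt
term-<lex-++ (y ∷ Y₁) (_ ∷ Y₂) R₁ R₂ (next eq lt) = next eq (term-<lex-++ Y₁ Y₂ R₁ R₂ lt)

Prefix-lcp : ∀ X A B → length X ≤ lcp A B → Prefix _≡_ X B → Prefix _≡_ X A
Prefix-lcp []      A       B       _  _          = []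
Prefix-lcp (x ∷ X) []      (b ∷ B) () _
Prefix-lcp (x ∷ X) (a ∷ A) (b ∷ B) le (refl ∷ pre) with a ≟ b
... | yes refl = refl ∷ Prefix-lcp X A B (s≤s⁻¹ le) pre
Prefix-lcp (x ∷ X) (a ∷ A) (b ∷ B) () (refl ∷ pre) | no _

docStart : (docs : List (List ℕ)) → Fin (length docs) → ℕ
docStart (B ∷ Bs) zero    = 0
docStart (B ∷ Bs) (suc k) = length (term B) + docStart Bs k

<⇒<ᵇ≡true : ∀ {m n} → m < n → (m <ᵇ n) ≡ true
<⇒<ᵇ≡true {m} {n} m<n with m <ᵇ n | <ᵇ-reflects-< m n
... | true  | _       = refl
... | false | ofⁿ m≮n = contradiction m<n m≮n

≤⇒<ᵇ≡false : ∀ {m n} → n ≤ m → (m <ᵇ n) ≡ false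
≤⇒<ᵇ≡false {m} {n} n≤m with m <ᵇ n | <ᵇ-reflects-< m n
... | false | _       = refl
... | true  | ofʸ m<n = contradiction m<n (≤⇒≯ n≤m)

locate-cons-< : ∀ B Bs p → p < length (term B) → locate (B ∷ Bs) p ≡ (0 , p)
locate-cons-< B Bs p p< rewrite <⇒<ᵇ≡true p< = refl

locate-cons-+ : ∀ B Bs x
              → locate (B ∷ Bs) (length (term B) + x) ≡ (suc (proj₁ (locate Bs x)) , proj₂ (locate Bs x))
locate-cons-+ B Bs x rewrite ≤⇒<ᵇ≡false (m≤m+n (length (term B)) x) | m+n∸m≡n (length (term B)) x = refl

locate-docStart : ∀ docs k o → o < length (doc docs k) → locate docs (docStart docs k + o) ≡ (toℕ k , o)
locate-docStart (B ∷ Bs) zero    o o< = locate-cons-< B Bs o o<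
locate-docStart (B ∷ Bs) (suc k) o o<
  rewrite +-assoc (length (term B)) (docStart Bs k) o
        | locate-cons-+ B Bs (docStart Bs k + o)
        | locate-docStart Bs k o o< = refl

docStart+<len : ∀ docs k o → o < length (doc docs k) → docStart docs k + o < len docs
docStart+<len (B ∷ Bs) zero    o o< = <-≤-trans o< (length-++-≤ˡ (term B))
docStart+<len (B ∷ Bs) (suc k) o o< = begin-strict
  length (term B) + docStart Bs k + o   ≡⟨ +-assoc (length (term B)) (docStart Bs k) o ⟩
  length (term B) + (docStart Bs k + o) <⟨ +-monoʳ-< (length (term B)) (docStart+<len Bs k o o<) ⟩
  length (term B) + len Bs              ≡⟨ length-++ (term B) ⟨
  len (B ∷ Bs)                          ∎
  where open ≤-Reasoning

drop-++-≤ : ∀ n (xs ys : List ℕ) → n ≤ length xs → drop n (xs ++ ys) ≡ drop n xs ++ ys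
drop-++-≤ zero    xs       ys _        = refl
drop-++-≤ (suc n) (x ∷ xs) ys (s≤s n≤) = drop-++-≤ n xs ys n≤

drop-length-++ : ∀ n (xs ys : List ℕ) → drop (length xs + n) (xs ++ ys) ≡ drop n ys
drop-length-++ n []       ys = refl
drop-length-++ n (x ∷ xs) ys = drop-length-++ n xs ys

suf-concatDocs-docStart : ∀ docs k o → o < length (doc docs k)
  → suf (concatDocs docs) (docStart docs k + o)
    ≡ term (drop o (lookup docs k)) ++ concatDocs (drop (suc (toℕ k)) docs)
suf-concatDocs-docStart (B ∷ Bs) zero    o o< =
  trans (drop-++-≤ o (term B) (concatDocs Bs) (<⇒≤ o<)) (cong (_++ concatDocs Bs) (suf-term B o o<))
suf-concatDocs-docStart (B ∷ Bs) (suc k) o o< = begin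
  drop (length (term B) + docStart Bs k + o) (term B ++ concatDocs Bs)
    ≡⟨ cong (λ n → drop n (term B ++ concatDocs Bs)) (+-assoc (length (term B)) (docStart Bs k) o) ⟩
  drop (length (term B) + (docStart Bs k + o)) (term B ++ concatDocs Bs)
    ≡⟨ drop-length-++ (docStart Bs k + o) (term B) (concatDocs Bs) ⟩
  suf (concatDocs Bs) (docStart Bs k + o)
    ≡⟨ suf-concatDocs-docStart Bs k o o< ⟩
  term (drop o (lookup Bs k)) ++ concatDocs (drop (suc (toℕ k)) Bs)
    ∎
  where open ≡-Reasoning

∸-length-< : ∀ (xs : List ℕ) {ys p} → length xs ≤ p → p < length (xs ++ ys) → p ∸ length xs < length ys
∸-length-< xs {ys} {p} xs≤p p< = subst (p ∸ length xs <_) (m+n∸m≡n (length xs) (length ys))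
  (∸-monoˡ-< (subst (p <_) (length-++ xs) p<) xs≤p)

docStart-surjective : ∀ docs p → p < len docs
  → Σ (Fin (length docs)) λ k → Σ ℕ λ o → o < length (doc docs k) × p ≡ docStart docs k + o
docStart-surjective (B ∷ Bs) p p< with p <? length (term B)
... | yes p<L = zero , p , p<L , refl
... | no p≮L with docStart-surjective Bs (p ∸ length (term B)) (∸-length-< (term B) (≮⇒≥ p≮L) p<)
... | k , o , o< , p∸L≡ = suc k , o , o< , (begin
  p                                       ≡⟨ m+[n∸m]≡n (≮⇒≥ p≮L) ⟨
  length (term B) + (p ∸ length (term B)) ≡⟨ cong (length (term B) +_) p∸L≡ ⟩
  length (term B) + (docStart Bs k + o)   ≡⟨ +-assoc (length (term B)) (docStart Bs k) o ⟨
  length (term B) + docStart Bs k + o     ∎)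
  where open ≡-Reasoning

Prefix-concatDocs⇔Prefix-doc : ∀ docs k o Z → o < length (doc docs k)
  → Prefix _≡_ (enc Z) (suf (concatDocs docs) (docStart docs k + o)) ⇔ Prefix _≡_ (enc Z) (suf (doc docs k) o)
Prefix-concatDocs⇔Prefix-doc docs k o Z o< = mk⇔
  (λ pre → subst (Prefix _≡_ (enc Z)) (sym (suf-term B o o<))
             (Prefix-enc-term-++⁻ Z (drop o B) rest (subst (Prefix _≡_ (enc Z)) sufD pre)))
  (λ pre → subst (Prefix _≡_ (enc Z)) (sym sufD)
             (subst (Prefix _≡_ (enc Z)) (suf-term B o o<) pre ++ᵖ rest))
  where
  B    = lookup docs k
  rest = concatDocs (drop (suc (toℕ k)) docs)
  sufD = suf-concatDocs-docStart docs k o o<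

<lex-doc⇒<lex-concatDocs : ∀ docs k o k′ o′ → o < length (doc docs k) → o′ < length (doc docs k′)
  → suf (doc docs k) o <lex suf (doc docs k′) o′
  → suf (concatDocs docs) (docStart docs k + o) <lex suf (concatDocs docs) (docStart docs k′ + o′)
<lex-doc⇒<lex-concatDocs docs k o k′ o′ o< o′< lt =
  subst₂ _<lex_ (sym (suf-concatDocs-docStart docs k o o<)) (sym (suf-concatDocs-docStart docs k′ o′ o′<))
    (term-<lex-++ _ _ _ _ (subst₂ _<lex_ (suf-term (lookup docs k) o o<) (suf-term (lookup docs k′) o′ o′<) lt))

LCPgen-zero-or-lcp-earlier : ∀ T {n} (pos : Fin n → ℕ) j
  → LCPgen T pos j ≡ 0
  ⊎ Σ (Fin n) λ i → toℕ i < toℕ j × LCPgen T pos j ≡ lcp (suf T (pos i)) (suf T (pos j))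
LCPgen-zero-or-lcp-earlier T pos zero    = inj₁ refl
LCPgen-zero-or-lcp-earlier T pos (suc j) = inj₂ (inject₁ j , s≤s (≤-reflexive (toℕ-inject₁ j)) , refl)

LCPArr-zero-or-lcp-smaller : ∀ {T SA} → IsSuffixArray T SA → ∀ j
  → LCPArr T SA j ≡ 0
  ⊎ Σ (Fin (length T)) λ i → suf T (toℕ (SA i)) <lex suf T (toℕ (SA j))
                           × LCPArr T SA j ≡ lcp (suf T (toℕ (SA i))) (suf T (toℕ (SA j)))
LCPArr-zero-or-lcp-smaller {T} {SA} (sorted , _) j with LCPgen-zero-or-lcp-earlier T (λ i → toℕ (SA i)) j
... | inj₁ LCP≡0                = inj₁ LCP≡0
... | inj₂ (i , i<j , LCP≡lcp) = inj₂ (i , sorted i j i<j , LCP≡lcp)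

IsLeftmost : {A : Set} → (A → ℕ) → (A → Set) → A → Set
IsLeftmost rank R x = R x × (∀ y → R y → rank x ≤ rank y)

leftmost-if-no-earlier : {A : Set} (rank : A → ℕ) (R Q : A → Set)
  → (∀ x → IsLeftmost rank R x → Q x)
  → ∀ {x} → R x → (∀ y → R y → rank y < rank x → ¬ Q y)
  → IsLeftmost rank R x
leftmost-if-no-earlier rank R Q leftmost⇒Q {x} Rx no-earlier-Q =
  Rx , λ y Ry → ≮⇒≥ (none-earlier y (<-wellFounded (rank y)) Ry)
  where
  none-earlier : ∀ y → Acc _<_ (rank y) → R y → ¬ rank y < rank x
  none-earlier y (acc rec) Ry y<x = no-earlier-Q y Ry y<x (leftmost⇒Q y
    (Ry , λ z Rz → ≮⇒≥ λ z<y → none-earlier z (rec z<y) Rz (<-trans z<y y<x)))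

module LeftmostOccurrences
  (docs : List (List ℕ))
  (SA : Fin (len docs) → Fin (len docs))
  (SA-sorted : IsSuffixArray (concatDocs docs) SA)
  (SAs : (k : Fin (length docs)) → Fin (length (doc docs k)) → Fin (length (doc docs k)))
  (SAs-sorted : ∀ k → IsSuffixArray (doc docs k) (SAs k))
  (ILCP : Fin (len docs) → ℕ)
  (ILCP-interleaves : IsILCP docs SA SAs ILCP)
  (Z : List ℕ)
  (sp ep : Fin (len docs))
  (interval : ∀ i → (toℕ sp ≤ toℕ i × toℕ i ≤ toℕ ep)
                    ⇔ Prefix _≡_ (enc Z) (suf (concatDocs docs) (toℕ (SA i))))
  where

  OccurrenceOf : ℕ → Fin (len docs) → Set
  OccurrenceOf d i = toℕ sp ≤ toℕ i × toℕ i ≤ toℕ ep × DA docs SA i ≡ d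

  locate-SA : ∀ {i k o} → toℕ (SA i) ≡ docStart docs k + o → o < length (doc docs k)
            → locate docs (toℕ (SA i)) ≡ (toℕ k , o)
  locate-SA {k = k} {o} SAi≡ o< = trans (cong (locate docs) SAi≡) (locate-docStart docs k o o<)

  occurrence⇒prefix-in-doc : ∀ {d q k o} → OccurrenceOf d q
    → toℕ (SA q) ≡ docStart docs k + o → o < length (doc docs k) → Prefix _≡_ (enc Z) (suf (doc docs k) o)
  occurrence⇒prefix-in-doc {q = q} {k} {o} (sp≤q , q≤ep , _) SAq≡ o< =
    Equivalence.to (Prefix-concatDocs⇔Prefix-doc docs k o Z o<)
      (subst (λ p → Prefix _≡_ (enc Z) (suf (concatDocs docs) p)) SAq≡
        (Equivalence.to (interval q) (sp≤q , q≤ep)))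

  leftmost⇒no-smaller-occurrence-in-doc : ∀ {d q k o o′} → IsLeftmost toℕ (OccurrenceOf d) q
    → toℕ (SA q) ≡ docStart docs k + o → o < length (doc docs k) → o′ < length (doc docs k)
    → suf (doc docs k) o′ <lex suf (doc docs k) o
    → ¬ Prefix _≡_ (enc Z) (suf (doc docs k) o′)
  leftmost⇒no-smaller-occurrence-in-doc {d} {q} {k} {o} {o′}
                                        ((_ , _ , DAq≡d) , leftmost) SAq≡ o< o′< smaller pre =
    <⇒≱ i′<q (leftmost i′ (proj₁ i′-in-interval , proj₂ i′-in-interval , DAi′≡d))
    where
    D = concatDocs docs
    hit : ∃ λ i → SA i ≡ fromℕ< (docStart+<len docs k o′ o′<)
    hit = proj₂ SA-sorted (fromℕ< (docStart+<len docs k o′ o′<))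
    i′ : Fin (len docs)
    i′ = proj₁ hit
    SAi′≡ : toℕ (SA i′) ≡ docStart docs k + o′
    SAi′≡ = trans (cong toℕ (proj₂ hit)) (toℕ-fromℕ< _)
    i′-in-interval : toℕ sp ≤ toℕ i′ × toℕ i′ ≤ toℕ ep
    i′-in-interval = Equivalence.from (interval i′)
      (subst (λ p → Prefix _≡_ (enc Z) (suf D p)) (sym SAi′≡)
        (Equivalence.from (Prefix-concatDocs⇔Prefix-doc docs k o′ Z o′<) pre))
    DAi′≡d : DA docs SA i′ ≡ d
    DAi′≡d = trans (cong proj₁ (locate-SA SAi′≡ o′<))
                   (trans (sym (cong proj₁ (locate-SA SAq≡ o<))) DAq≡d)
    i′<q : toℕ i′ < toℕ q
    i′<q = SA-reflects-<lex SA-sorted i′ q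
      (subst₂ (λ a b → suf D a <lex suf D b) (sym SAi′≡) (sym SAq≡)
        (<lex-doc⇒<lex-concatDocs docs k o′ k o o′< o< smaller))

  leftmost⇒LCP< : 0 < length Z → ∀ {d q k j} → IsLeftmost toℕ (OccurrenceOf d) q
    → toℕ (SA q) ≡ docStart docs k + toℕ (SAs k j) → LCPArr (doc docs k) (SAs k) j < length Z
  leftmost⇒LCP< Z≢[] {k = k} {j} lm SAq≡ with LCPArr-zero-or-lcp-smaller (SAs-sorted k) j
  ... | inj₁ LCP≡0 = subst (_< length Z) (sym LCP≡0) Z≢[]
  ... | inj₂ (i , smaller , LCP≡lcp) = subst (_< length Z) (sym LCP≡lcp) (≰⇒> λ Z≤lcp →
    leftmost⇒no-smaller-occurrence-in-doc lm SAq≡ (toℕ<n (SAs k j)) (toℕ<n (SAs k i)) smaller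
      (Prefix-lcp (enc Z) _ _ (subst (_≤ _) (sym (length-map suc Z)) Z≤lcp)
        (occurrence⇒prefix-in-doc (proj₁ lm) SAq≡ (toℕ<n (SAs k j)))))

  leftmost⇒ILCP< : 0 < length Z → ∀ {d q} → IsLeftmost toℕ (OccurrenceOf d) q → ILCP q < length Z
  leftmost⇒ILCP< Z≢[] {q = q} lm with docStart-surjective docs (toℕ (SA q)) (toℕ<n (SA q))
  ... | k , o , o< , SAq≡ with proj₂ (SAs-sorted k) (fromℕ< o<)
  ... | j , SAsj≡ = subst (_< length Z) (sym ILCPq≡)
                      (leftmost⇒LCP< Z≢[] lm (trans SAq≡ (cong (docStart docs k +_) (sym SAsj≡o))))
    where
    SAsj≡o : toℕ (SAs k j) ≡ o
    SAsj≡o = trans (cong toℕ SAsj≡) (toℕ-fromℕ< o<)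
    ILCPq≡ : ILCP q ≡ LCPArr (doc docs k) (SAs k) j
    ILCPq≡ = ILCP-interleaves q k j (sym (cong proj₁ (locate-SA SAq≡ o<)))
                                   (trans SAsj≡o (sym (cong proj₂ (locate-SA SAq≡ o<))))

lemma2 : (docs : List (List ℕ))
  → (SA : Fin (len docs) → Fin (len docs))
  → IsSuffixArray (concatDocs docs) SA
  → (SAs : (k : Fin (length docs)) → Fin (length (doc docs k)) → Fin (length (doc docs k)))
  → (∀ k → IsSuffixArray (doc docs k) (SAs k))
  → (ILCP : Fin (len docs) → ℕ)
  → IsILCP docs SA SAs ILCP
  → (p : ℕ) (P : List ℕ)
  → (∃ λ i → Prefix _≡_ (enc (p ∷ P)) (suf (concatDocs docs) (toℕ (SA i))))
  → (sp ep : Fin (len docs))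
  → toℕ sp ≤ toℕ ep
  → (∀ i → (toℕ sp ≤ toℕ i × toℕ i ≤ toℕ ep)
           ⇔ Prefix _≡_ (enc (p ∷ P)) (suf (concatDocs docs) (toℕ (SA i))))
  → ∀ (q : Fin (len docs))
  → (Σ ℕ λ d →
        (toℕ sp ≤ toℕ q × toℕ q ≤ toℕ ep × DA docs SA q ≡ d)
      × (∀ (q' : Fin (len docs)) → toℕ sp ≤ toℕ q' → toℕ q' ≤ toℕ ep
           → DA docs SA q' ≡ d → toℕ q ≤ toℕ q'))
    ⇔ (toℕ sp ≤ toℕ q × toℕ q ≤ toℕ ep
        × ILCPstar ILCP (DA docs SA) q < length (p ∷ P)
        × (∀ (q' : Fin (len docs)) → toℕ sp ≤ toℕ q' → toℕ q' < toℕ q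
             → DA docs SA q' ≡ DA docs SA q
             → ¬ (ILCPstar ILCP (DA docs SA) q' < length (p ∷ P))))
lemma2 docs SA SA-sorted SAs SAs-sorted ILCP ILCP-interleaves p P _ sp ep _ interval q = mk⇔
  (λ (d , occ@(sp≤q , q≤ep , DAq≡d) , first) →
    let leftmost : IsLeftmost toℕ (OccurrenceOf d) q
        leftmost = occ , λ i (sp≤i , i≤ep , DAi≡d) → first i sp≤i i≤ep DAi≡d
    in  sp≤q , q≤ep , leftmost⇒small d q leftmost
      , λ i sp≤i i<q DAi≡DAq _ →
          <⇒≱ i<q (first i sp≤i (≤-trans (<⇒≤ i<q) q≤ep) (trans DAi≡DAq DAq≡d)))
  (λ (sp≤q , q≤ep , _ , no-earlier-small) →
    let leftmost : IsLeftmost toℕ (OccurrenceOf (DA docs SA q)) q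
        leftmost = leftmost-if-no-earlier toℕ (OccurrenceOf (DA docs SA q)) Small
                     (leftmost⇒small (DA docs SA q)) (sp≤q , q≤ep , refl)
                     λ i (sp≤i , _ , DAi≡DAq) i<q → no-earlier-small i sp≤i i<q DAi≡DAq
    in  DA docs SA q , proj₁ leftmost
      , λ i sp≤i i≤ep DAi≡DAq → proj₂ leftmost i (sp≤i , i≤ep , DAi≡DAq))
  where
  open LeftmostOccurrences docs SA SA-sorted SAs SAs-sorted ILCP ILCP-interleaves (p ∷ P) sp ep interval

  Small : Fin (len docs) → Set
  Small i = ILCPstar ILCP (DA docs SA) i < length (p ∷ P)

  leftmost⇒small : ∀ d i → IsLeftmost toℕ (OccurrenceOf d) i → Small i
  leftmost⇒small d i leftmost =
    ≤-<-trans (ILCPstar≤ILCP ILCP (DA docs SA) i) (leftmost⇒ILCP< (s≤s z≤n) leftmost)
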